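{- Let $v>k>i\ge 0$ be integers with $v\ge 2k$ and $(v,k,i)\neq(2k,k,0)$, let $X=J(v,k,i)$ and $\Delta=v-2k+2i$, and assume the girth of $X$ is $4$. Then the odd girth of $X$ satisfies $og(X)\ge 2\left\lceil\frac{k-i}{\Delta}\right\rceil+1$.
   Context: For integers $v>k>i\ge 0$, the generalized Johnson graph $J(v,k,i)$ is the simple undirected graph whose vertices are the $k$-element subsets of a fixed $v$-element set, two vertices $A,B$ being adjacent iff $|A\cap B|=i$. The girth is the length of a shortest cycle; the odd girth is the length of a shortest odd cycle. -}

module Defs where

open import Data.Nat using (ℕ; zero; suc; _+_; _*_; _∸_; _≤_; _<_)
open import Data.Nat.DivMod using (_/_)
open import Data.Fin using (Fin; zero; suc; inject₁; fromℕ)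
open import Data.Fin.Subset using (Subset; _∩_; ∣_∣)
open import Data.Product using (Σ; _×_; ∃; proj₁; _,_)
open import Relation.Binary.PropositionalEquality using (_≡_)
open import Function.Definitions using (Injective)
open import Function using (_∘_)

Vertex : (v k : ℕ) → Set
Vertex v k = Σ (Subset v) (λ A → ∣ A ∣ ≡ k)

Adj : (v k i : ℕ) → Vertex v k → Vertex v k → Set
Adj v k i (A , _) (B , _) = ∣ A ∩ B ∣ ≡ i

-- A cycle of length (suc m) in J(v,k,i): pairwise distinct vertices
-- c 0, c 1, ..., c m with c j ~ c (j+1) for j < m and c m ~ c 0,
-- where the length suc m is at least 3.
record Cycle (v k i m : ℕ) : Set where
  field
    length≥3 : 3 ≤ suc m
    vert     : Fin (suc m) → Vertex v k
    distinct : Injective _≡_ _≡_ (proj₁ ∘ vert)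
    step     : (j : Fin m) → Adj v k i (vert (inject₁ j)) (vert (suc j))
    close    : Adj v k i (vert (fromℕ m)) (vert zero)

HasCycleOfLength : (v k i n : ℕ) → Set
HasCycleOfLength v k i zero    = Data.Empty.⊥
  where import Data.Empty
HasCycleOfLength v k i (suc m) = Cycle v k i m

GirthIs : (v k i g : ℕ) → Set
GirthIs v k i g = HasCycleOfLength v k i g × (∀ n → HasCycleOfLength v k i n → g ≤ n)

-- odd girth of J(v,k,i) is at least b (vacuous if there is no odd cycle,
-- i.e. odd girth = ∞): every cycle of odd length n has n ≥ b.
OddGirth≥ : (v k i b : ℕ) → Set
OddGirth≥ v k i b = ∀ n → HasCycleOfLength v k i (suc (2 * n)) → b ≤ suc (2 * n)

-- ceiling division ⌈a / b⌉ for b > 0 (b = 0 never arises below: set to 0).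
ceilDiv : ℕ → ℕ → ℕ
ceilDiv a zero    = zero
ceilDiv a (suc b) = (a + b) / suc b

-- Fix a closed walk c₀ c₁ … c₂ₙ c₀ of odd length and put yₜ = |cₜ ∩ c₀|.  For adjacent
-- cₜ, cₜ₊₁, counting in the three k-sets c₀, cₜ, cₜ₊₁ gives
--   3k − v − i ≤ yₜ + yₜ₊₁ ≤ k + i,
-- so y drops by at most Δ = v − 2k + 2i over two steps: y₂ₛ ≥ k − sΔ.  As c₂ₙ ~ c₀,
-- y₂ₙ = i, hence k − i ≤ nΔ.
module Submission where

open import Defs
open import Data.Nat using (ℕ; zero; suc; _+_; _*_; _∸_; _≤_; _<_; z≤n; s≤s; s≤s⁻¹)
open import Data.Nat.Properties
open import Data.Nat.DivMod using (_/_; m<n*o⇒m/o<n)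
open import Data.Nat.Solver using (module +-*-Solver)
open import Data.Vec using ([]; _∷_)
open import Data.Fin using (Fin; zero; suc; inject₁; fromℕ)
open import Data.Fin.Subset using (Subset; _∩_; _∪_; _⊆_; ∣_∣; inside; outside)
open import Data.Fin.Subset.Properties
  using (p⊆q⇒∣p∣≤∣q∣; ∣p∩q∣≤∣q∣; ∣p∣≤n; x∈p∩q⁺; x∈p∩q⁻; ∩-distribʳ-∪; ∩-idem)
open import Data.Product using (_×_; _,_; proj₁)
open import Relation.Binary.PropositionalEquality
open import Relation.Nullary using (¬_)
open import Function using (_∘_)

open import Algebra.Properties.CommutativeSemigroup +-commutativeSemigroup using (xy∙z≈xz∙y)

open +-*-Solver

∣p∪q∣+∣p∩q∣≡∣p∣+∣q∣ : ∀ {n} (p q : Subset n) → ∣ p ∪ q ∣ + ∣ p ∩ q ∣ ≡ ∣ p ∣ + ∣ q ∣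
∣p∪q∣+∣p∩q∣≡∣p∣+∣q∣ []            []            = refl
∣p∪q∣+∣p∩q∣≡∣p∣+∣q∣ (inside  ∷ p) (inside  ∷ q) =
  cong suc (trans (+-suc _ _) (trans (cong suc (∣p∪q∣+∣p∩q∣≡∣p∣+∣q∣ p q)) (sym (+-suc _ _))))
∣p∪q∣+∣p∩q∣≡∣p∣+∣q∣ (inside  ∷ p) (outside ∷ q) = cong suc (∣p∪q∣+∣p∩q∣≡∣p∣+∣q∣ p q)
∣p∪q∣+∣p∩q∣≡∣p∣+∣q∣ (outside ∷ p) (inside  ∷ q) =
  trans (cong suc (∣p∪q∣+∣p∩q∣≡∣p∣+∣q∣ p q)) (sym (+-suc _ _))
∣p∪q∣+∣p∩q∣≡∣p∣+∣q∣ (outside ∷ p) (outside ∷ q) = ∣p∪q∣+∣p∩q∣≡∣p∣+∣q∣ p q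

∣p∪q∣≤∣p∣+∣q∣ : ∀ {n} (p q : Subset n) → ∣ p ∪ q ∣ ≤ ∣ p ∣ + ∣ q ∣
∣p∪q∣≤∣p∣+∣q∣ p q = subst (∣ p ∪ q ∣ ≤_) (∣p∪q∣+∣p∩q∣≡∣p∣+∣q∣ p q) (m≤m+n _ _)

[p∩r]∩[q∩r]⊆p∩q : ∀ {n} (p q r : Subset n) → (p ∩ r) ∩ (q ∩ r) ⊆ p ∩ q
[p∩r]∩[q∩r]⊆p∩q p q r x∈ with x∈p∩q⁻ (p ∩ r) (q ∩ r) x∈
... | x∈p∩r , x∈q∩r = x∈p∩q⁺ (proj₁ (x∈p∩q⁻ p r x∈p∩r) , proj₁ (x∈p∩q⁻ q r x∈q∩r))

∣p∩r∣+∣q∩r∣≤∣r∣+∣p∩q∣ : ∀ {n} (p q r : Subset n) →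
                        ∣ p ∩ r ∣ + ∣ q ∩ r ∣ ≤ ∣ r ∣ + ∣ p ∩ q ∣
∣p∩r∣+∣q∩r∣≤∣r∣+∣p∩q∣ p q r = begin
  ∣ p ∩ r ∣ + ∣ q ∩ r ∣                                ≡⟨ sym (∣p∪q∣+∣p∩q∣≡∣p∣+∣q∣ (p ∩ r) (q ∩ r)) ⟩
  ∣ (p ∩ r) ∪ (q ∩ r) ∣ + ∣ (p ∩ r) ∩ (q ∩ r) ∣        ≡⟨ cong (λ s → ∣ s ∣ + ∣ (p ∩ r) ∩ (q ∩ r) ∣) (sym (∩-distribʳ-∪ r p q)) ⟩
  ∣ (p ∪ q) ∩ r ∣ + ∣ (p ∩ r) ∩ (q ∩ r) ∣              ≤⟨ +-mono-≤ (∣p∩q∣≤∣q∣ (p ∪ q) r)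
                                                           (p⊆q⇒∣p∣≤∣q∣ ([p∩r]∩[q∩r]⊆p∩q p q r)) ⟩
  ∣ r ∣ + ∣ p ∩ q ∣                                    ∎
  where open ≤-Reasoning

∣p∣+∣q∣+∣r∣≤n+∣p∩q∣+∣p∩r∣+∣q∩r∣ : ∀ {n} (p q r : Subset n) →
  ∣ p ∣ + ∣ q ∣ + ∣ r ∣ ≤ n + ∣ p ∩ q ∣ + (∣ p ∩ r ∣ + ∣ q ∩ r ∣)
∣p∣+∣q∣+∣r∣≤n+∣p∩q∣+∣p∩r∣+∣q∩r∣ {n} p q r = begin
  ∣ p ∣ + ∣ q ∣ + ∣ r ∣                          ≡⟨ cong (_+ ∣ r ∣) (sym (∣p∪q∣+∣p∩q∣≡∣p∣+∣q∣ p q)) ⟩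
  ∣ p ∪ q ∣ + ∣ p ∩ q ∣ + ∣ r ∣                  ≡⟨ xy∙z≈xz∙y ∣ p ∪ q ∣ _ _ ⟩
  ∣ p ∪ q ∣ + ∣ r ∣ + ∣ p ∩ q ∣                  ≡⟨ cong (_+ ∣ p ∩ q ∣) (sym (∣p∪q∣+∣p∩q∣≡∣p∣+∣q∣ (p ∪ q) r)) ⟩
  ∣ (p ∪ q) ∪ r ∣ + ∣ (p ∪ q) ∩ r ∣ + ∣ p ∩ q ∣  ≡⟨ cong (λ s → ∣ (p ∪ q) ∪ r ∣ + ∣ s ∣ + ∣ p ∩ q ∣) (∩-distribʳ-∪ r p q) ⟩
  ∣ (p ∪ q) ∪ r ∣ + ∣ (p ∩ r) ∪ (q ∩ r) ∣ + ∣ p ∩ q ∣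
    ≤⟨ +-monoˡ-≤ ∣ p ∩ q ∣ (+-mono-≤ (∣p∣≤n ((p ∪ q) ∪ r)) (∣p∪q∣≤∣p∣+∣q∣ (p ∩ r) (q ∩ r))) ⟩
  n + (∣ p ∩ r ∣ + ∣ q ∩ r ∣) + ∣ p ∩ q ∣        ≡⟨ xy∙z≈xz∙y n _ _ ⟩
  n + ∣ p ∩ q ∣ + (∣ p ∩ r ∣ + ∣ q ∩ r ∣)        ∎
  where open ≤-Reasoning

double : ℕ → ℕ
double zero    = zero
double (suc n) = suc (suc (double n))

2*n≡double : ∀ n → 2 * n ≡ double n
2*n≡double zero    = refl
2*n≡double (suc n) = cong suc (trans (+-suc n (n + 0)) (cong suc (2*n≡double n)))

ceilDiv-≤ : ∀ {a b n} → a ≤ n * b → ceilDiv a b ≤ n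
ceilDiv-≤ {b = zero}          _     = z≤n
ceilDiv-≤ {a} {suc d} {n} a≤n*b = s≤s⁻¹ (m<n*o⇒m/o<n (begin-strict
  a + d              ≤⟨ +-monoˡ-≤ d a≤n*b ⟩
  n * suc d + d      <⟨ +-monoʳ-< (n * suc d) (n<1+n d) ⟩
  n * suc d + suc d  ≡⟨ +-comm (n * suc d) (suc d) ⟩
  suc n * suc d      ∎))
  where open ≤-Reasoning

module JohnsonWalks (v k i : ℕ) (2k≤v : 2 * k ≤ v) where

  Walk : ∀ m → (Fin (suc m) → Vertex v k) → Set
  Walk m f = (j : Fin m) → Adj v k i (f (inject₁ j)) (f (suc j))

  meet : Vertex v k → Vertex v k → ℕ
  meet (A , _) (B , _) = ∣ A ∩ B ∣

  meet-self : (a : Vertex v k) → meet a a ≡ k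
  meet-self (A , ∣A∣≡k) = trans (cong ∣_∣ (∩-idem A)) ∣A∣≡k

  meet-adjacent-upper : (a b c : Vertex v k) → Adj v k i b c →
                        meet b a + meet c a ≤ k + i
  meet-adjacent-upper (A , ∣A∣≡k) (B , _) (C , _) B~C =
    subst₂ (λ x y → _ ≤ x + y) ∣A∣≡k B~C (∣p∩r∣+∣q∩r∣≤∣r∣+∣p∩q∣ B C A)

  meet-adjacent-lower : (a b c : Vertex v k) → Adj v k i b c →
                        k + k + k ≤ v + i + (meet b a + meet c a)
  meet-adjacent-lower (A , ∣A∣≡k) (B , ∣B∣≡k) (C , ∣C∣≡k) B~C =
    subst₂ _≤_ (cong₂ _+_ (cong₂ _+_ ∣B∣≡k ∣C∣≡k) ∣A∣≡k) (cong (λ x → v + x + _) B~C)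
      (∣p∣+∣q∣+∣r∣≤n+∣p∩q∣+∣p∩r∣+∣q∩r∣ B C A)

  Δ : ℕ
  Δ = v ∸ 2 * k + 2 * i

  Δ+2k≡v+2i : Δ + 2 * k ≡ v + 2 * i
  Δ+2k≡v+2i = begin
    v ∸ 2 * k + 2 * i + 2 * k  ≡⟨ xy∙z≈xz∙y (v ∸ 2 * k) (2 * i) (2 * k) ⟩
    v ∸ 2 * k + 2 * k + 2 * i  ≡⟨ cong (_+ 2 * i) (m∸n+n≡m 2k≤v) ⟩
    v + 2 * i                  ∎
    where open ≡-Reasoning

  odd-step : ∀ {x y d} → x + y ≤ k + i → k ≤ x + d → y ≤ i + d
  odd-step {x} {y} {d} x+y≤k+i k≤x+d = +-cancelˡ-≤ k y (i + d) (begin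
    k + y        ≤⟨ +-monoˡ-≤ y k≤x+d ⟩
    x + d + y    ≡⟨ xy∙z≈xz∙y x d y ⟩
    x + y + d    ≤⟨ +-monoˡ-≤ d x+y≤k+i ⟩
    k + i + d    ≡⟨ +-assoc k i d ⟩
    k + (i + d)  ∎)
    where open ≤-Reasoning

  even-step : ∀ {y z d} → k + k + k ≤ v + i + (y + z) → y ≤ i + d →
              k ≤ z + (Δ + d)
  even-step {y} {z} {d} 3k≤ y≤i+d = +-cancelʳ-≤ (2 * k) k (z + (Δ + d)) (begin
    k + 2 * k                  ≡⟨ solve 1 (λ k → k :+ con 2 :* k := k :+ k :+ k) refl k ⟩
    k + k + k                  ≤⟨ 3k≤ ⟩
    v + i + (y + z)            ≤⟨ +-monoʳ-≤ (v + i) (+-monoˡ-≤ z y≤i+d) ⟩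
    v + i + (i + d + z)        ≡⟨ solve 4 (λ v i d z → v :+ i :+ (i :+ d :+ z) := v :+ con 2 :* i :+ (z :+ d)) refl v i d z ⟩
    v + 2 * i + (z + d)        ≡⟨ cong (_+ (z + d)) (sym (Δ+2k≡v+2i)) ⟩
    Δ + 2 * k + (z + d)        ≡⟨ solve 4 (λ D k2 z d → D :+ k2 :+ (z :+ d) := z :+ (D :+ d) :+ k2) refl Δ (2 * k) z d ⟩
    z + (Δ + d) + 2 * k        ∎)
    where open ≤-Reasoning

  meet-two-steps : ∀ {d} → (a b c e : Vertex v k) → Adj v k i b c → Adj v k i c e →
                   k ≤ meet b a + d → k ≤ meet e a + (Δ + d)
  meet-two-steps {d} a b c e b~c c~e k≤b =
    even-step {meet c a} {meet e a} {d} (meet-adjacent-lower a c e c~e)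
      (odd-step {meet b a} (meet-adjacent-upper a b c b~c) k≤b)

  even-walk-bound : ∀ s (f : Fin (suc (double s)) → Vertex v k) → Walk (double s) f →
                    k ≤ meet (f (fromℕ (double s))) (f zero) + s * Δ
  even-walk-bound zero    f _ = ≤-trans (≤-reflexive (sym (meet-self (f zero)))) (m≤m+n _ 0)
  even-walk-bound (suc s) f w =
    meet-two-steps (f zero) (f (inject₁ (inject₁ (fromℕ d)))) (f (inject₁ (fromℕ (suc d))))
      (f (fromℕ (suc (suc d)))) (w (inject₁ (fromℕ d))) (w (fromℕ (suc d)))
      (even-walk-bound s (f ∘ inject₁ ∘ inject₁) (w ∘ inject₁ ∘ inject₁))
    where d = double s

lemma5p3 : (v k i : ℕ) → i < k → k < v → 2 * k ≤ v →
           ¬ (v ≡ 2 * k × i ≡ 0) →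
           GirthIs v k i 4 →
           OddGirth≥ v k i (2 * ceilDiv (k ∸ i) (v ∸ 2 * k + 2 * i) + 1)
lemma5p3 v k i _ _ 2k≤v _ _ n cycle =
  subst (_≤ suc (2 * n)) (+-comm 1 _) (s≤s (*-monoʳ-≤ 2 ⌈k∸i/Δ⌉≤n))
  where
  open JohnsonWalks v k i 2k≤v
  open Cycle (subst (Cycle v k i) (2*n≡double n) cycle)
  k≤i+nΔ : k ≤ i + n * Δ
  k≤i+nΔ = subst (λ x → k ≤ x + n * Δ) close (even-walk-bound n vert step)
  ⌈k∸i/Δ⌉≤n : ceilDiv (k ∸ i) Δ ≤ n
  ⌈k∸i/Δ⌉≤n = ceilDiv-≤ {b = Δ} (m≤n+o⇒m∸n≤o k i k≤i+nΔ)
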